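{- Let $n\ge 2$. For every $\pi\in\mathcal{S}_n^2$, $\mathrm{IPF}_2(n,\pi)=2^{\mathrm{asc}(\pi)-1}$. Moreover, \[\mathrm{IPF}_2(n)=\sum_{k=1}^{n-1}(n-k)\left\langle {n-1 \atop k-1}\right\rangle 2^{k-1}.\]
   Context: Let $[n]=\{1,\dots,n\}$, $\mathcal{S}_n$ the permutations of $[n]$ in one-line notation, and $\pi_i^{ -1}$ the position $j$ with $\pi_j=i$. A tuple $(C_1,\dots,C_n)$ of non-empty subsets of $[n]$ is a subset parking function with outcome $\pi$ if for every $1\le i\le n$, $\pi_i^{ -1}$ is the smallest element of $C_i\setminus\{\pi_{i'}^{ -1}:i'<i\}$. A $2$-interval parking function is such a tuple in which every $C_i$ is a set $\{a,a+1\}\subseteq[n]$; $\mathrm{IPF}_2(n,\pi)$ counts those with outcome $\pi$ and $\mathrm{IPF}_2(n)$ counts all of them. $\mathcal{S}_n^2$ is the set of $\pi\in\mathcal{S}_n$ with $\pi_{n-1}<\pi_n$. The ascent number $\mathrm{asc}(\pi)$ is the number of $i$ with $2\le i\le n$ and $\pi_{i-1}<\pi_i$. The Eulerian number $\left\langle {m \atop k}\right\rangle$ is the number of $\pi\in\mathcal{S}_m$ with $\mathrm{asc}(\pi)=k$, with conventions $\left\langle {0 \atop 0}\right\rangle=1$, $\left\langle {0 \atop k}\right\rangle=0$ for $k>0$, and $\left\langle {m \atop -1}\right\rangle=0$. -}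

module Defs where

open import Data.Nat using (ℕ; zero; suc; _+_; _*_; _∸_; _^_; _≡ᵇ_; _<ᵇ_; _≤ᵇ_)
open import Data.Bool using (Bool; true; false; if_then_else_; _∧_; _∨_; not)
open import Data.Fin using (Fin; toℕ)
open import Data.Vec using (Vec; lookup; toList) renaming ([] to []ᵥ; _∷_ to _∷ᵥ_)
open import Data.List using (List; []; _∷_; map; concatMap; filterᵇ; allFin; upTo; foldr)
open import Data.Bool.ListAction using (all; any)
open import Relation.Binary.PropositionalEquality using (_≡_)

vecsOver : {A : Set} → List A → (k : ℕ) → List (Vec A k)
vecsOver L zero = []ᵥ ∷ []
vecsOver L (suc k) = concatMap (λ x → map (x ∷ᵥ_) (vecsOver L k)) L

countB : {A : Set} → (A → Bool) → List A → ℕ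
countB p [] = 0
countB p (x ∷ xs) = (if p x then 1 else 0) + countB p xs

memB : ℕ → List ℕ → Bool
memB x = any (λ y → x ≡ᵇ y)

-- Permutations in one-line notation: π : Vec (Fin n) n, where the
-- paper's π_j is  lookup π j  (indices/values shifted down by one,
-- which preserves order).

IsPerm : {n : ℕ} → Vec (Fin n) n → Set
IsPerm {n} π = ∀ (i j : Fin n) → lookup π i ≡ lookup π j → i ≡ j

isPermB : {n : ℕ} → Vec (Fin n) n → Bool
isPermB {n} π = all (λ i → all (λ j → (toℕ i ≡ᵇ toℕ j) ∨ not (toℕ (lookup π i) ≡ᵇ toℕ (lookup π j))) (allFin n)) (allFin n)

-- π^{-1}_i as a 1-indexed position in [n]: the (first) j with π_j = i.
posOf : {n : ℕ} → Vec (Fin n) n → Fin n → ℕ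
posOf {n} π i = foldr (λ j acc → if toℕ (lookup π j) ≡ᵇ toℕ i then suc (toℕ j) else acc) 0 (allFin n)

ascL : List ℕ → ℕ
ascL [] = 0
ascL (x ∷ []) = 0
ascL (x ∷ y ∷ xs) = (if x <ᵇ y then 1 else 0) + ascL (y ∷ xs)

asc : {n : ℕ} → Vec (Fin n) n → ℕ
asc π = ascL (map toℕ (toList π))

-- A 2-interval tuple (C_1,…,C_n) with C_i = {a_i, a_i+1} ⊆ [n] is encoded
-- by the vector of starting points a_i ∈ {1,…,n-1}; car i of the paper is
-- the index i-1 : Fin n.

interval2 : ℕ → List ℕ
interval2 a = a ∷ suc a ∷ []

starts : ℕ → List ℕ
starts n = map suc (upTo (n ∸ 1))

tuples2 : (n : ℕ) → List (Vec ℕ n)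
tuples2 n = vecsOver (starts n) n

isSmallest : ℕ → List ℕ → Bool
isSmallest p L = memB p L ∧ all (λ x → p ≤ᵇ x) L

earlier : {n : ℕ} → Vec (Fin n) n → Fin n → List ℕ
earlier {n} π i = map (posOf π) (filterᵇ (λ i' → toℕ i' <ᵇ toℕ i) (allFin n))

remaining : {n : ℕ} → Vec (Fin n) n → Vec ℕ n → Fin n → List ℕ
remaining π C i = filterᵇ (λ c → not (memB c (earlier π i))) (interval2 (lookup C i))

hasOutcome : {n : ℕ} → Vec (Fin n) n → Vec ℕ n → Bool
hasOutcome {n} π C = all (λ i → isSmallest (posOf π i) (remaining π C i)) (allFin n)

IPF2 : (n : ℕ) → Vec (Fin n) n → ℕ
IPF2 n π = countB (hasOutcome π) (tuples2 n)

IPF2total : ℕ → ℕ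
IPF2total n = countB (λ C → any (λ π → isPermB π ∧ hasOutcome π C) (vecsOver (allFin n) n)) (tuples2 n)

eulerian : ℕ → ℕ → ℕ
eulerian m k = countB (λ π → isPermB π ∧ (asc π ≡ᵇ k)) (vecsOver (allFin m) m)

eulerSum : ℕ → ℕ
eulerSum n = foldr _+_ 0 (map (λ k → (n ∸ k) * eulerian (n ∸ 1) (k ∸ 1) * 2 ^ (k ∸ 1)) (map suc (upTo (n ∸ 1))))

-- Per permutation: the car π_j must park at spot j, and the spots taken before
-- it are those of the smaller letters.  So its preference {a, a+1} is admissible
-- iff a = j < n, or a + 1 = j and π_{j-1} < π_j.  By the product principle
-- IPF₂(n,π) is the product of these spot weights, 1 · Π (1 + [π_{j-1} < π_j]) ·
-- [π_{n-1} < π_n], i.e. 2^{asc π - 1} if π ends with an ascent and 0 otherwise.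
--
-- Total: outcomes are unique, so IPF₂(n) = Σ_{π ∈ S_n, π ends with an ascent}
-- 2^{asc π - 1}.  Listing permutations as words built by inserting the largest
-- letter ('perms'), an induction with an arbitrary weight φ gives
--   Σ_{π ∈ S_n ending with an ascent} φ(asc π) = Σ_{σ ∈ S_{n-1}} (1 + des σ) φ(1 + asc σ),
-- and grouping σ by its ascent number yields the Eulerian sum.

module Submission where

open import Defs
open import Data.Nat
open import Data.Nat.Properties
open import Data.Nat.ListAction using (sum; product)
open import Data.Nat.ListAction.Properties using (sum-++; sum-↭; product-↭)
open import Data.Nat.Tactic.RingSolver using (solve-∀)
open import Data.Bool using (Bool; true; false; if_then_else_; _∧_; _∨_; not; T)
open import Data.Bool.Properties using (T-≡; ∨-zeroʳ; ∧-zeroʳ; ∧-identityʳ; not-involutive)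
open import Data.Bool.ListAction using (all; any)
open import Data.Fin using (Fin; toℕ; fromℕ; fromℕ<; inject₁; punchOut) renaming (zero to fzero; suc to fsuc; _<_ to _<ᶠ_)
open import Data.Fin.Properties using (toℕ-injective; toℕ<n; toℕ-fromℕ<; toℕ-inject₁; injective⇒≤; punchOut-injective; any?)
import Data.Fin.Properties as Fin
open import Data.Fin.Induction using () renaming (<-wellFounded to <ᶠ-wellFounded)
open import Data.Vec using (Vec; lookup; toList; head) renaming ([] to []ᵥ; _∷_ to _∷ᵥ_)
import Data.Vec.Properties as Vec
open import Data.Vec.Membership.Propositional.Properties using (∈-lookup; ∈-toList⁺; ∈-toList⁻)
import Data.Vec.Relation.Unary.Any as VecAny
open import Data.Vec.Relation.Unary.Any.Properties using (lookup-index)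
open import Data.List using (List; []; _∷_; map; concatMap; concat; filterᵇ; _++_; length; upTo; allFin; tabulate; [_])
open import Data.List.Properties using (map-++; applyUpTo-∷ʳ; ∷-injectiveʳ; map-injective; length-map; map-tabulate; map-cong-local)
open import Data.List.Membership.Propositional using (_∈_)
open import Data.List.Membership.Propositional.Properties
  using (∈-concat⁻′; ∈-concat⁺′; ∈-map⁻; ∈-map⁺; ∈-∃++; ∈-upTo⁻; ∈-allFin; ∈-filter⁺; ∈-filter⁻)
open import Data.List.Membership.Propositional.Properties.WithK using (unique∧set⇒bag)
open import Data.List.Membership.DecPropositional _≟_ using (_∈?_)
open import Data.List.Relation.Unary.Any using (here; there)
open import Data.List.Relation.Unary.All using (All; []; _∷_)
import Data.List.Relation.Unary.All as All
import Data.List.Relation.Unary.All.Properties as All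
open import Data.List.Relation.Unary.Unique.Propositional using (Unique; []; _∷_)
import Data.List.Relation.Unary.Unique.Propositional.Properties as Unique
open import Data.List.Relation.Binary.Disjoint.Propositional using (Disjoint)
open import Data.List.Relation.Binary.BagAndSetEquality using (∼bag⇒↭)
open import Data.List.Relation.Binary.Permutation.Propositional using (_↭_)
import Data.List.Relation.Binary.Permutation.Propositional.Properties as Perm
open import Data.Product using (_×_; _,_; ∃; proj₁; proj₂)
open import Data.Empty using (⊥-elim)
open import Function using (_∘_; mk⇔)
open import Function.Bundles using (Equivalence)
import Induction.WellFounded as WF
open import Level using (0ℓ)
open import Relation.Nullary using (¬_; yes; no; Dec)
open import Relation.Nullary.Decidable using (T?)
open import Relation.Binary.PropositionalEquality hiding ([_])

𝟙 : Bool → ℕ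
𝟙 b = if b then 1 else 0

T⇒≡true : ∀ {b} → T b → b ≡ true
T⇒≡true = Equivalence.to T-≡

≡true⇒T : ∀ {b} → b ≡ true → T b
≡true⇒T = Equivalence.from T-≡

≡ᵇ-refl : ∀ m → (m ≡ᵇ m) ≡ true
≡ᵇ-refl m = T⇒≡true (≡⇒≡ᵇ m m refl)

≡ᵇ-sym : ∀ m n → (m ≡ᵇ n) ≡ (n ≡ᵇ m)
≡ᵇ-sym zero zero = refl
≡ᵇ-sym zero (suc n) = refl
≡ᵇ-sym (suc m) zero = refl
≡ᵇ-sym (suc m) (suc n) = ≡ᵇ-sym m n

≡ᵇ-sound : ∀ m n → (m ≡ᵇ n) ≡ true → m ≡ n
≡ᵇ-sound m n e = ≡ᵇ⇒≡ m n (≡true⇒T e)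

≡ᵇ-false : ∀ m n → m ≢ n → (m ≡ᵇ n) ≡ false
≡ᵇ-false m n m≢n with m ≡ᵇ n in eq
... | true = ⊥-elim (m≢n (≡ᵇ-sound m n eq))
... | false = refl

<ᵇ-true : ∀ {m n} → m < n → (m <ᵇ n) ≡ true
<ᵇ-true m<n = T⇒≡true (<⇒<ᵇ m<n)

<ᵇ-sound : ∀ {m n} → (m <ᵇ n) ≡ true → m < n
<ᵇ-sound e = <ᵇ⇒< _ _ (≡true⇒T e)

<ᵇ-false : ∀ {m n} → ¬ (m < n) → (m <ᵇ n) ≡ false
<ᵇ-false {m} {n} m≮n with m <ᵇ n in eq
... | true = ⊥-elim (m≮n (<ᵇ-sound eq))
... | false = refl

≤ᵇ-true : ∀ {m n} → m ≤ n → (m ≤ᵇ n) ≡ true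
≤ᵇ-true m≤n = T⇒≡true (≤⇒≤ᵇ m≤n)

≤ᵇ-sound : ∀ {m n} → (m ≤ᵇ n) ≡ true → m ≤ n
≤ᵇ-sound e = ≤ᵇ⇒≤ _ _ (≡true⇒T e)

∧-true : ∀ {a b} → (a ∧ b) ≡ true → a ≡ true × b ≡ true
∧-true {true} {true} _ = refl , refl

memB-sound : ∀ x L → memB x L ≡ true → x ∈ L
memB-sound x (y ∷ L) e with x ≡ᵇ y in eq
... | true = here (≡ᵇ-sound x y eq)
... | false = there (memB-sound x L e)

memB-complete : ∀ x L → x ∈ L → memB x L ≡ true
memB-complete x (y ∷ L) (here refl) rewrite ≡ᵇ-refl x = refl
memB-complete x (y ∷ L) (there x∈L) rewrite memB-complete x L x∈L = ∨-zeroʳ _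

memB-false : ∀ x L → ¬ (x ∈ L) → memB x L ≡ false
memB-false x L x∉L with memB x L in eq
... | true = ⊥-elim (x∉L (memB-sound x L eq))
... | false = refl

∑ : {A : Set} → (A → ℕ) → List A → ℕ
∑ f xs = sum (map f xs)

∑-++ : {A : Set} (f : A → ℕ) (xs ys : List A) → ∑ f (xs ++ ys) ≡ ∑ f xs + ∑ f ys
∑-++ f xs ys = trans (cong sum (map-++ f xs ys)) (sum-++ (map f xs) (map f ys))

∑-map : {A B : Set} (f : B → ℕ) (g : A → B) (xs : List A) → ∑ f (map g xs) ≡ ∑ (f ∘ g) xs
∑-map f g [] = refl
∑-map f g (x ∷ xs) = cong (f (g x) +_) (∑-map f g xs)

∑-concatMap : {A B : Set} (f : B → ℕ) (g : A → List B) (xs : List A) →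
  ∑ f (concatMap g xs) ≡ ∑ (λ x → ∑ f (g x)) xs
∑-concatMap f g [] = refl
∑-concatMap f g (x ∷ xs) =
  trans (∑-++ f (g x) (concat (map g xs))) (cong (∑ f (g x) +_) (∑-concatMap f g xs))

∑-cong : {A : Set} {f g : A → ℕ} (xs : List A) → (∀ x → x ∈ xs → f x ≡ g x) → ∑ f xs ≡ ∑ g xs
∑-cong [] h = refl
∑-cong (x ∷ xs) h = cong₂ _+_ (h x (here refl)) (∑-cong xs (λ y y∈ → h y (there y∈)))

∑-zero : {A : Set} (f : A → ℕ) (xs : List A) → (∀ x → x ∈ xs → f x ≡ 0) → ∑ f xs ≡ 0
∑-zero f [] h = refl
∑-zero f (x ∷ xs) h rewrite h x (here refl) = ∑-zero f xs (λ y y∈ → h y (there y∈))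

∑-+ : {A : Set} (f g : A → ℕ) (xs : List A) → ∑ (λ x → f x + g x) xs ≡ ∑ f xs + ∑ g xs
∑-+ f g [] = refl
∑-+ f g (x ∷ xs) rewrite ∑-+ f g xs = interchange (f x) (g x) (∑ f xs) (∑ g xs)
  where
  interchange : ∀ a b c d → a + b + (c + d) ≡ a + c + (b + d)
  interchange = solve-∀

∑-*ʳ : {A : Set} (f : A → ℕ) (c : ℕ) (xs : List A) → ∑ (λ x → f x * c) xs ≡ ∑ f xs * c
∑-*ʳ f c [] = refl
∑-*ʳ f c (x ∷ xs) rewrite ∑-*ʳ f c xs = sym (*-distribʳ-+ c (f x) (∑ f xs))

∑-swap : {A B : Set} (f : A → B → ℕ) (xs : List A) (ys : List B) →
  ∑ (λ x → ∑ (f x) ys) xs ≡ ∑ (λ y → ∑ (λ x → f x y) xs) ys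
∑-swap f [] ys = sym (∑-zero _ ys (λ _ _ → refl))
∑-swap f (x ∷ xs) ys =
  trans (cong (∑ (f x) ys +_) (∑-swap f xs ys)) (sym (∑-+ (f x) (λ y → ∑ (λ x → f x y) xs) ys))

∑-↭ : {A : Set} (f : A → ℕ) {xs ys : List A} → xs ↭ ys → ∑ f xs ≡ ∑ f ys
∑-↭ f p = sum-↭ (Perm.map⁺ f p)

∑-filter : {A : Set} (p : A → Bool) (f : A → ℕ) (xs : List A) →
  ∑ (λ x → if p x then f x else 0) xs ≡ ∑ f (filterᵇ p xs)
∑-filter p f [] = refl
∑-filter p f (x ∷ xs) with p x
... | true = cong (f x +_) (∑-filter p f xs)
... | false = ∑-filter p f xs

countB≡∑ : {A : Set} (p : A → Bool) (xs : List A) → countB p xs ≡ ∑ (𝟙 ∘ p) xs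
countB≡∑ p [] = refl
countB≡∑ p (x ∷ xs) = cong (𝟙 (p x) +_) (countB≡∑ p xs)

∑-pick : (h : ℕ → ℕ) (v N : ℕ) → v < N → ∑ (λ j → h j * 𝟙 (v ≡ᵇ j)) (upTo N) ≡ h v
∑-pick h v (suc N) v<1+N =
  trans (cong (∑ F) (sym (applyUpTo-∷ʳ (λ x → x) N)))
        (trans (∑-++ F (upTo N) [ N ]) (last (v ≟ N)))
  where
  F : ℕ → ℕ
  F j = h j * 𝟙 (v ≡ᵇ j)
  off : ∀ j → v ≢ j → F j ≡ 0
  off j v≢j = trans (cong (λ b → h j * 𝟙 b) (≡ᵇ-false v j v≢j)) (*-zeroʳ (h j))
  last : Dec (v ≡ N) → ∑ F (upTo N) + ∑ F [ N ] ≡ h v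
  last (yes refl) rewrite ∑-zero F (upTo v) (λ j j∈ → off j (>⇒≢ (∈-upTo⁻ j∈)))
                        | ≡ᵇ-refl v = trans (+-identityʳ (h v * 1)) (*-identityʳ (h v))
  last (no v≢N) rewrite ∑-pick h v N (≤∧≢⇒< (≤-pred v<1+N) v≢N) | off N v≢N = +-identityʳ (h v)

∑-byValue : {A : Set} (g : A → ℕ) (f : ℕ → ℕ) (N : ℕ) (xs : List A) → (∀ x → x ∈ xs → g x < N) →
  ∑ (f ∘ g) xs ≡ ∑ (λ j → f j * countB (λ x → g x ≡ᵇ j) xs) (upTo N)
∑-byValue g f N [] h = sym (∑-zero _ (upTo N) (λ j _ → *-zeroʳ (f j)))
∑-byValue g f N (x ∷ xs) h =
  begin
    f (g x) + ∑ (f ∘ g) xs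
  ≡⟨ cong₂ _+_ (sym (∑-pick f (g x) N (h x (here refl)))) (∑-byValue g f N xs (λ y y∈ → h y (there y∈))) ⟩
    ∑ (λ j → f j * 𝟙 (g x ≡ᵇ j)) (upTo N) + ∑ (λ j → f j * countB (λ x → g x ≡ᵇ j) xs) (upTo N)
  ≡⟨ sym (∑-+ _ _ (upTo N)) ⟩
    ∑ (λ j → f j * 𝟙 (g x ≡ᵇ j) + f j * countB (λ x → g x ≡ᵇ j) xs) (upTo N)
  ≡⟨ ∑-cong (upTo N) (λ j _ → sym (*-distribˡ-+ (f j) (𝟙 (g x ≡ᵇ j)) _)) ⟩
    ∑ (λ j → f j * countB (λ x → g x ≡ᵇ j) (x ∷ xs)) (upTo N)
  ∎
  where open ≡-Reasoning

sameElements⇒↭ : {A : Set} {xs ys : List A} → Unique xs → Unique ys →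
  (∀ {x} → x ∈ xs → x ∈ ys) → (∀ {x} → x ∈ ys → x ∈ xs) → xs ↭ ys
sameElements⇒↭ uxs uys xs⊆ys ys⊆xs = ∼bag⇒↭ (unique∧set⇒bag uxs uys (mk⇔ xs⊆ys ys⊆xs))

unique-concatMap : {A B : Set} (f : A → List B) (key : B → A) (xs : List A) → Unique xs →
  (∀ x → x ∈ xs → Unique (f x)) → (∀ x → x ∈ xs → ∀ z → z ∈ f x → key z ≡ x) →
  Unique (concatMap f xs)
unique-concatMap f key [] _ _ _ = []
unique-concatMap f key (x ∷ xs) (x∉xs ∷ uxs) ublock hkey =
  Unique.++⁺ (ublock x (here refl))
      (unique-concatMap f key xs uxs (λ y y∈ → ublock y (there y∈)) (λ y y∈ → hkey y (there y∈)))
      disjoint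
  where
  disjoint : Disjoint (f x) (concat (map f xs))
  disjoint (z∈fx , z∈rest) with ∈-concat⁻′ (map f xs) z∈rest
  ... | ys , z∈ys , ys∈ with ∈-map⁻ f ys∈
  ... | y , y∈xs , refl =
    All.lookup x∉xs y∈xs (trans (sym (hkey x (here refl) _ z∈fx)) (hkey y (there y∈xs) _ z∈ys))

des : List ℕ → ℕ
des [] = 0
des (x ∷ []) = 0
des (x ∷ y ∷ xs) = 𝟙 (not (x <ᵇ y)) + des (y ∷ xs)

endsWithAscent : List ℕ → Bool
endsWithAscent [] = false
endsWithAscent (x ∷ []) = false
endsWithAscent (x ∷ y ∷ []) = x <ᵇ y
endsWithAscent (x ∷ y ∷ z ∷ r) = endsWithAscent (y ∷ z ∷ r)

lastAscentWeight : (ℕ → ℕ) → List ℕ → ℕ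
lastAscentWeight φ w = if endsWithAscent w then φ (ascL w) else 0

asc+des : ∀ y ℓ → ascL (y ∷ ℓ) + des (y ∷ ℓ) ≡ length ℓ
asc+des y [] = refl
asc+des y (z ∷ ℓ) with y <ᵇ z
... | true = cong suc (asc+des z ℓ)
... | false = trans (+-suc (ascL (z ∷ ℓ)) _) (cong suc (asc+des z ℓ))

endsWithAscent⇒asc≥1 : ∀ ℓ → endsWithAscent ℓ ≡ true → 1 ≤ ascL ℓ
endsWithAscent⇒asc≥1 (x ∷ y ∷ []) e rewrite e = s≤s z≤n
endsWithAscent⇒asc≥1 (x ∷ y ∷ z ∷ r) e =
  ≤-trans (endsWithAscent⇒asc≥1 (y ∷ z ∷ r) e) (m≤n+m _ (𝟙 (x <ᵇ y)))

insertions : ℕ → List ℕ → List (List ℕ)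
insertions x [] = [ x ∷ [] ]
insertions x (y ∷ ℓ) = (x ∷ y ∷ ℓ) ∷ map (y ∷_) (insertions x ℓ)

perms : ℕ → List (List ℕ)
perms zero = [ [] ]
perms (suc n) = concatMap (insertions n) (perms n)

∈-perms-suc : ∀ {n w} → w ∈ perms (suc n) → ∃ λ ℓ → ℓ ∈ perms n × w ∈ insertions n ℓ
∈-perms-suc {n} w∈ with ∈-concat⁻′ (map (insertions n) (perms n)) w∈
... | ws , w∈ws , ws∈ with ∈-map⁻ (insertions n) ws∈
... | ℓ , ℓ∈ , refl = ℓ , ℓ∈ , w∈ws

insertions-nonempty : ∀ x ℓ {w} → w ∈ insertions x ℓ → ∃ λ u → ∃ λ w' → w ≡ u ∷ w'
insertions-nonempty x [] (here refl) = x , [] , refl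
insertions-nonempty x (y ∷ ℓ) (here refl) = x , y ∷ ℓ , refl
insertions-nonempty x (y ∷ ℓ) (there w∈) with ∈-map⁻ (y ∷_) w∈
... | w' , _ , refl = y , w' , refl

insertions-length : ∀ x ℓ {w} → w ∈ insertions x ℓ → length w ≡ suc (length ℓ)
insertions-length x [] (here refl) = refl
insertions-length x (y ∷ ℓ) (here refl) = refl
insertions-length x (y ∷ ℓ) (there w∈) with ∈-map⁻ (y ∷_) w∈
... | w' , w'∈ , refl = cong suc (insertions-length x ℓ w'∈)

insertions-All : ∀ {P : ℕ → Set} x ℓ {w} → w ∈ insertions x ℓ → P x → All P ℓ → All P w
insertions-All x [] (here refl) px [] = px ∷ []
insertions-All x (y ∷ ℓ) (here refl) px pℓ = px ∷ pℓ
insertions-All x (y ∷ ℓ) (there w∈) px (py ∷ pℓ) with ∈-map⁻ (y ∷_) w∈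
... | w' , w'∈ , refl = py ∷ insertions-All x ℓ w'∈ px pℓ

perms-shape : ∀ n {ℓ} → ℓ ∈ perms n → length ℓ ≡ n × All (_< n) ℓ
perms-shape zero (here refl) = refl , []
perms-shape (suc n) w∈ with ∈-perms-suc w∈
... | ℓ , ℓ∈ , w∈ins with perms-shape n ℓ∈
... | len , bound =
  trans (insertions-length n ℓ w∈ins) (cong suc len) ,
  insertions-All n ℓ w∈ins ≤-refl (All.map (λ p → ≤-trans p (n≤1+n _)) bound)

perms-nonempty : ∀ k {ℓ} → ℓ ∈ perms (suc k) → ∃ λ y → ∃ λ ℓ₀ → ℓ ≡ y ∷ ℓ₀
perms-nonempty k {[]} ℓ∈ with perms-shape (suc k) ℓ∈
... | () , _
perms-nonempty k {y ∷ ℓ₀} ℓ∈ = y , ℓ₀ , refl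

des-perms : ∀ k {ℓ} → ℓ ∈ perms (suc k) → des ℓ ≡ k ∸ ascL ℓ
des-perms k ℓ∈ with perms-nonempty k ℓ∈ | perms-shape (suc k) ℓ∈
... | y , ℓ₀ , refl | len , _ =
  trans (sym (m+n∸m≡n (ascL (y ∷ ℓ₀)) (des (y ∷ ℓ₀))))
        (cong (_∸ ascL (y ∷ ℓ₀)) (trans (asc+des y ℓ₀) (suc-injective len)))

asc-perms : ∀ k {ℓ} → ℓ ∈ perms (suc k) → ascL ℓ ≤ k
asc-perms k ℓ∈ with perms-nonempty k ℓ∈ | perms-shape (suc k) ℓ∈
... | y , ℓ₀ , refl | len , _ =
  subst (ascL (y ∷ ℓ₀) ≤_) (trans (asc+des y ℓ₀) (suc-injective len)) (m≤m+n _ _)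

-- Inserting a letter x larger than every letter of y ∷ ℓ into a slot after y:
-- a slot inside an ascent keeps the ascent number, a slot inside a descent or
-- the final slot raises it by one.
∑-insertAfterHead-asc : ∀ x y ℓ (φ : ℕ → ℕ) → All (_< x) (y ∷ ℓ) →
  ∑ (λ w → φ (ascL (y ∷ w))) (insertions x ℓ) ≡
    ascL (y ∷ ℓ) * φ (ascL (y ∷ ℓ)) + suc (des (y ∷ ℓ)) * φ (suc (ascL (y ∷ ℓ)))
∑-insertAfterHead-asc x y [] φ (y<x ∷ []) rewrite <ᵇ-true y<x =
  trans (+-identityʳ _) (sym (+-identityʳ _))
∑-insertAfterHead-asc x y (z ∷ ℓ) φ (y<x ∷ z<x ∷ rest)
  rewrite ∑-map (λ w → φ (ascL (y ∷ w))) (z ∷_) (insertions x ℓ)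
        | ∑-insertAfterHead-asc x z ℓ (λ a → φ (𝟙 (y <ᵇ z) + a)) (z<x ∷ rest)
        | <ᵇ-true y<x | <ᵇ-false (<-asym z<x) with y <ᵇ z
... | true = slots (ascL (z ∷ ℓ)) (des (z ∷ ℓ)) (φ (suc (ascL (z ∷ ℓ)))) (φ (suc (suc (ascL (z ∷ ℓ)))))
  where
  slots : ∀ a d p q → p + (a * p + suc d * q) ≡ suc a * p + suc d * q
  slots = solve-∀
... | false = slots (ascL (z ∷ ℓ)) (des (z ∷ ℓ)) (φ (ascL (z ∷ ℓ))) (φ (suc (ascL (z ∷ ℓ))))
  where
  slots : ∀ a d p q → q + (a * p + suc d * q) ≡ a * p + suc (suc d) * q
  slots = solve-∀

-- The classical Eulerian recursion: inserting a new largest letter into the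
-- n+1 slots of a nonempty word, the front slot and the ascent slots keep the
-- ascent number, the descent slots and the final slot raise it by one.
∑-insert-asc : ∀ x y ℓ (φ : ℕ → ℕ) → All (_< x) (y ∷ ℓ) →
  ∑ (φ ∘ ascL) (insertions x (y ∷ ℓ)) ≡
    suc (ascL (y ∷ ℓ)) * φ (ascL (y ∷ ℓ)) + suc (des (y ∷ ℓ)) * φ (suc (ascL (y ∷ ℓ)))
∑-insert-asc x y ℓ φ (y<x ∷ rest)
  rewrite ∑-map (φ ∘ ascL) (y ∷_) (insertions x ℓ) | ∑-insertAfterHead-asc x y ℓ φ (y<x ∷ rest)
        | <ᵇ-false (<-asym y<x) =
  sym (+-assoc (φ (ascL (y ∷ ℓ))) _ _)

-- The statement of '∑-insertAfterHead-lastAsc' below: inserting x after the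
-- head y, the final slot always produces a word ending with an ascent; the
-- other slots do so only if y ∷ ℓ ends with an ascent, and then these are
-- the asc - 1 earlier ascent slots and the des descent slots.
InsertAfterHeadLastAsc : ℕ → ℕ → List ℕ → (ℕ → ℕ) → Set
InsertAfterHeadLastAsc x y ℓ φ =
  ∑ (λ w → lastAscentWeight φ (y ∷ w)) (insertions x ℓ) ≡
    φ (suc (ascL (y ∷ ℓ))) +
      (if endsWithAscent (y ∷ ℓ)
       then pred (ascL (y ∷ ℓ)) * φ (ascL (y ∷ ℓ)) + des (y ∷ ℓ) * φ (suc (ascL (y ∷ ℓ)))
       else 0)

lastAscentWeight-dropHead : ∀ (φ : ℕ → ℕ) y z w → (∃ λ u → ∃ λ w' → w ≡ u ∷ w') →
  lastAscentWeight φ (y ∷ z ∷ w) ≡ lastAscentWeight (λ a → φ (𝟙 (y <ᵇ z) + a)) (z ∷ w)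
lastAscentWeight-dropHead φ y z w (u , w' , refl) = refl

insertAfterHead-lastAsc-step : ∀ x y z u ℓ (φ : ℕ → ℕ) → y < x → z < x →
  InsertAfterHeadLastAsc x z (u ∷ ℓ) (λ a → φ (𝟙 (y <ᵇ z) + a)) → InsertAfterHeadLastAsc x y (z ∷ u ∷ ℓ) φ
insertAfterHead-lastAsc-step x y z u ℓ φ y<x z<x IH
  rewrite ∑-map (λ w → lastAscentWeight φ (y ∷ w)) (z ∷_) (insertions x (u ∷ ℓ))
        | ∑-cong {f = λ w → lastAscentWeight φ (y ∷ z ∷ w)}
                 {g = λ w → lastAscentWeight (λ a → φ (𝟙 (y <ᵇ z) + a)) (z ∷ w)}
                 (insertions x (u ∷ ℓ)) (λ w w∈ → lastAscentWeight-dropHead φ y z w (insertions-nonempty x (u ∷ ℓ) w∈))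
        | IH | <ᵇ-true y<x | <ᵇ-false (<-asym z<x)
  with endsWithAscent (z ∷ u ∷ ℓ) in ends | y <ᵇ z
... | true | true = ascentCase (ascL (z ∷ u ∷ ℓ)) (endsWithAscent⇒asc≥1 (z ∷ u ∷ ℓ) ends)
  where
  ascentCase : ∀ a → 1 ≤ a →
    φ (suc a) + (φ (suc (suc a)) + (pred a * φ (suc a) + des (z ∷ u ∷ ℓ) * φ (suc (suc a))))
      ≡ φ (suc (suc a)) + (a * φ (suc a) + des (z ∷ u ∷ ℓ) * φ (suc (suc a)))
  ascentCase (suc a) _ = slots a (des (z ∷ u ∷ ℓ)) (φ (suc (suc a))) (φ (suc (suc (suc a))))
    where
    slots : ∀ a d p q → p + (q + (a * p + d * q)) ≡ q + (suc a * p + d * q)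
    slots = solve-∀
... | true | false =
  slots (pred (ascL (z ∷ u ∷ ℓ))) (des (z ∷ u ∷ ℓ)) (φ (ascL (z ∷ u ∷ ℓ))) (φ (suc (ascL (z ∷ u ∷ ℓ))))
  where
  slots : ∀ a d p q → q + (q + (a * p + d * q)) ≡ q + (a * p + suc d * q)
  slots = solve-∀
... | false | true = refl
... | false | false = refl

∑-insertAfterHead-lastAsc : ∀ x y ℓ (φ : ℕ → ℕ) → All (_< x) (y ∷ ℓ) → InsertAfterHeadLastAsc x y ℓ φ
∑-insertAfterHead-lastAsc x y [] φ (y<x ∷ []) rewrite <ᵇ-true y<x = refl
∑-insertAfterHead-lastAsc x y (z ∷ []) φ (y<x ∷ z<x ∷ [])
  rewrite <ᵇ-true y<x | <ᵇ-false (<-asym z<x) | <ᵇ-true z<x with y <ᵇ z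
... | true = refl
... | false = refl
∑-insertAfterHead-lastAsc x y (z ∷ u ∷ ℓ) φ (y<x ∷ z<x ∷ rest) =
  insertAfterHead-lastAsc-step x y z u ℓ φ y<x z<x
    (∑-insertAfterHead-lastAsc x z (u ∷ ℓ) (λ a → φ (𝟙 (y <ᵇ z) + a)) (z<x ∷ rest))

-- Inserting a new largest letter into a nonempty word ℓ: the final slot
-- always yields a word ending with an ascent (with asc ℓ + 1 ascents); if ℓ
-- ends with an ascent, so do the words from the front slot and the asc ℓ - 1
-- earlier ascent slots (asc ℓ ascents) and the des ℓ descent slots (asc ℓ + 1).
∑-insert-lastAsc : ∀ x y ℓ (φ : ℕ → ℕ) → All (_< x) (y ∷ ℓ) →
  ∑ (lastAscentWeight φ) (insertions x (y ∷ ℓ)) ≡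
    φ (suc (ascL (y ∷ ℓ))) +
      (if endsWithAscent (y ∷ ℓ)
       then ascL (y ∷ ℓ) * φ (ascL (y ∷ ℓ)) + des (y ∷ ℓ) * φ (suc (ascL (y ∷ ℓ)))
       else 0)
∑-insert-lastAsc x y [] φ (y<x ∷ []) rewrite <ᵇ-false (<-asym y<x) | <ᵇ-true y<x = refl
∑-insert-lastAsc x y (z ∷ ℓ) φ (y<x ∷ rest)
  rewrite ∑-map (lastAscentWeight φ) (y ∷_) (insertions x (z ∷ ℓ))
        | ∑-insertAfterHead-lastAsc x y (z ∷ ℓ) φ (y<x ∷ rest) | <ᵇ-false (<-asym y<x)
  with endsWithAscent (y ∷ z ∷ ℓ) in ends
... | true = frontSlot (ascL (y ∷ z ∷ ℓ)) (endsWithAscent⇒asc≥1 (y ∷ z ∷ ℓ) ends)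
  where
  frontSlot : ∀ a → 1 ≤ a → φ a + (φ (suc a) + (pred a * φ a + des (y ∷ z ∷ ℓ) * φ (suc a)))
                            ≡ φ (suc a) + (a * φ a + des (y ∷ z ∷ ℓ) * φ (suc a))
  frontSlot (suc a) _ = slots a (des (y ∷ z ∷ ℓ)) (φ (suc a)) (φ (suc (suc a)))
    where
    slots : ∀ a d p q → p + (q + (a * p + d * q)) ≡ q + (suc a * p + d * q)
    slots = solve-∀
... | false = refl

-- The weight that a word of length M + 1 passes on to its insertions, as a
-- function of its ascent number a (its descent number being M - a).
insertionWeight : ℕ → (ℕ → ℕ) → ℕ → ℕ
insertionWeight M φ a = a * φ a + (M ∸ a) * φ (suc a)

-- Sorting the permutations of {0,…,M+1} by the word left after deleting the
-- largest letter, via '∑-insert-lastAsc'.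
lastAscentSum-removeMax : ∀ M (φ : ℕ → ℕ) →
  ∑ (lastAscentWeight φ) (perms (suc (suc M))) ≡
    ∑ (λ ℓ → φ (suc (ascL ℓ))) (perms (suc M)) + ∑ (lastAscentWeight (insertionWeight M φ)) (perms (suc M))
lastAscentSum-removeMax M φ =
  trans (∑-concatMap (lastAscentWeight φ) (insertions (suc M)) (perms (suc M)))
        (trans (∑-cong (perms (suc M)) perWord)
               (∑-+ (λ ℓ → φ (suc (ascL ℓ))) (lastAscentWeight (insertionWeight M φ)) (perms (suc M))))
  where
  perWord : ∀ ℓ → ℓ ∈ perms (suc M) →
    ∑ (lastAscentWeight φ) (insertions (suc M) ℓ) ≡ φ (suc (ascL ℓ)) + lastAscentWeight (insertionWeight M φ) ℓ
  perWord ℓ ℓ∈ with perms-nonempty M ℓ∈ | perms-shape (suc M) ℓ∈ | des-perms M ℓ∈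
  ... | y , ℓ₀ , refl | _ , bound | des≡ rewrite ∑-insert-lastAsc (suc M) y ℓ₀ φ bound | des≡
    with endsWithAscent (y ∷ ℓ₀)
  ... | true = refl
  ... | false = refl

-- The descent-weighted sum over permutations of {0,…,m+1}, again by
-- deleting the largest letter, now via the Eulerian recursion '∑-insert-asc'.
desSum-removeMax : ∀ m (φ : ℕ → ℕ) →
  ∑ (λ ℓ → des ℓ * φ (suc (ascL ℓ))) (perms (suc (suc m))) ≡
    ∑ (λ τ → suc (des τ) * insertionWeight (suc m) φ (suc (ascL τ))) (perms (suc m))
desSum-removeMax m φ =
  begin
    ∑ (λ ℓ → des ℓ * φ (suc (ascL ℓ))) (perms (suc (suc m)))
  ≡⟨ ∑-cong (perms (suc (suc m))) (λ ℓ ℓ∈ → cong (_* φ (suc (ascL ℓ))) (des-perms (suc m) ℓ∈)) ⟩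
    ∑ (ψ ∘ ascL) (perms (suc (suc m)))
  ≡⟨ ∑-concatMap (ψ ∘ ascL) (insertions (suc m)) (perms (suc m)) ⟩
    ∑ (λ τ → ∑ (ψ ∘ ascL) (insertions (suc m) τ)) (perms (suc m))
  ≡⟨ ∑-cong (perms (suc m)) perWord ⟩
    ∑ (λ τ → suc (des τ) * insertionWeight (suc m) φ (suc (ascL τ))) (perms (suc m))
  ∎
  where
  open ≡-Reasoning
  ψ : ℕ → ℕ
  ψ a = (suc m ∸ a) * φ (suc a)
  regroup : ∀ a d → a + d ≡ m →
    suc a * ψ a + suc d * ψ (suc a) ≡ suc d * insertionWeight (suc m) φ (suc a)
  regroup a d refl rewrite +-∸-assoc 1 (m≤m+n a d) | m+n∸m≡n a d =
    slots a d (φ (suc a)) (φ (suc (suc a)))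
    where
    slots : ∀ a d p q → suc a * (suc d * p) + suc d * (d * q) ≡ suc d * (suc a * p + d * q)
    slots = solve-∀
  perWord : ∀ τ → τ ∈ perms (suc m) →
    ∑ (ψ ∘ ascL) (insertions (suc m) τ) ≡ suc (des τ) * insertionWeight (suc m) φ (suc (ascL τ))
  perWord τ τ∈ with perms-nonempty m τ∈ | perms-shape (suc m) τ∈
  ... | y , τ₀ , refl | len , bound =
    trans (∑-insert-asc (suc m) y τ₀ ψ bound)
          (regroup (ascL (y ∷ τ₀)) (des (y ∷ τ₀)) (trans (asc+des y τ₀) (suc-injective len)))

lastAscentSum : ∀ m (φ : ℕ → ℕ) →
  ∑ (lastAscentWeight φ) (perms (suc (suc m))) ≡ ∑ (λ ℓ → suc (des ℓ) * φ (suc (ascL ℓ))) (perms (suc m))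
lastAscentSum zero φ = trans (+-identityʳ (φ 1)) (sym (trans (+-identityʳ _) (+-identityʳ _)))
lastAscentSum (suc m) φ =
  begin
    ∑ (lastAscentWeight φ) (perms (3 + m))
  ≡⟨ lastAscentSum-removeMax (suc m) φ ⟩
    ∑ (λ ℓ → φ (suc (ascL ℓ))) (perms (2 + m)) + ∑ (lastAscentWeight (insertionWeight (suc m) φ)) (perms (2 + m))
  ≡⟨ cong (∑ (λ ℓ → φ (suc (ascL ℓ))) (perms (2 + m)) +_)
          (trans (lastAscentSum m (insertionWeight (suc m) φ)) (sym (desSum-removeMax m φ))) ⟩
    ∑ (λ ℓ → φ (suc (ascL ℓ))) (perms (2 + m)) + ∑ (λ ℓ → des ℓ * φ (suc (ascL ℓ))) (perms (2 + m))
  ≡⟨ sym (∑-+ _ _ (perms (2 + m))) ⟩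
    ∑ (λ ℓ → suc (des ℓ) * φ (suc (ascL ℓ))) (perms (2 + m))
  ∎
  where open ≡-Reasoning

All-delete : ∀ {P : ℕ → Set} xs x ys → All P (xs ++ x ∷ ys) → P x × All P (xs ++ ys)
All-delete xs x ys all with All.++⁻ xs all
... | pxs , px ∷ pys = px , All.++⁺ pxs pys

length-delete : ∀ (xs : List ℕ) x ys → length (xs ++ x ∷ ys) ≡ suc (length (xs ++ ys))
length-delete [] x ys = refl
length-delete (z ∷ xs) x ys = cong suc (length-delete xs x ys)

below-without : ∀ {k ℓ} → All (_< suc k) ℓ → (∀ {x} → x ∈ ℓ → x ≢ k) → All (_< k) ℓ
below-without bound x≢k = All.tabulate (λ x∈ → ≤∧≢⇒< (≤-pred (All.lookup bound x∈)) (x≢k x∈))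

deleteMax : ∀ k xs ys → Unique (xs ++ k ∷ ys) → All (_< suc k) (xs ++ k ∷ ys) →
  Unique (xs ++ ys) × All (_< k) (xs ++ ys)
deleteMax k [] ys (k∉ys ∷ u) (_ ∷ bound) =
  u , below-without bound (λ x∈ e → All.lookup k∉ys x∈ (sym e))
deleteMax k (z ∷ xs) ys (z∉ ∷ u) (z<1+k ∷ bound) with deleteMax k xs ys u bound | All-delete xs k ys z∉
... | u' , bound' | z≢k , z∉' = (z∉' ∷ u') , (≤∧≢⇒< (≤-pred z<1+k) z≢k ∷ bound')

unique⇒length≤ : ∀ k ℓ → Unique ℓ → All (_< k) ℓ → length ℓ ≤ k
unique⇒length≤ zero [] _ _ = z≤n
unique⇒length≤ zero (x ∷ ℓ) _ (() ∷ _)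
unique⇒length≤ (suc k) ℓ u bound with k ∈? ℓ
... | yes k∈ℓ = viaDeletion (∈-∃++ k∈ℓ)
  where
  viaDeletion : (∃ λ xs → ∃ λ ys → ℓ ≡ xs ++ [ k ] ++ ys) → length ℓ ≤ suc k
  viaDeletion (xs , ys , refl) with deleteMax k xs ys u bound
  ... | u' , bound' =
    subst (_≤ suc k) (sym (length-delete xs k ys)) (s≤s (unique⇒length≤ k (xs ++ ys) u' bound'))
... | no k∉ℓ =
  m≤n⇒m≤1+n (unique⇒length≤ k ℓ u (below-without bound (λ x∈ e → k∉ℓ (subst (_∈ ℓ) e x∈))))

max∈ : ∀ k ℓ → Unique ℓ → All (_< suc k) ℓ → length ℓ ≡ suc k → k ∈ ℓ
max∈ k ℓ u bound len with k ∈? ℓ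
... | yes k∈ℓ = k∈ℓ
... | no k∉ℓ = ⊥-elim (<-irrefl len (s≤s (unique⇒length≤ k ℓ u
                  (below-without bound (λ x∈ e → k∉ℓ (subst (_∈ ℓ) e x∈))))))

∈-insertions : ∀ x xs ys → xs ++ x ∷ ys ∈ insertions x (xs ++ ys)
∈-insertions x [] [] = here refl
∈-insertions x [] (y ∷ ys) = here refl
∈-insertions x (z ∷ xs) ys = there (∈-map⁺ (z ∷_) (∈-insertions x xs ys))

perms-complete : ∀ n ℓ → Unique ℓ → All (_< n) ℓ → length ℓ ≡ n → ℓ ∈ perms n
perms-complete zero [] _ _ _ = here refl
perms-complete (suc k) ℓ u bound len = viaDeletion (∈-∃++ (max∈ k ℓ u bound len))
  where
  viaDeletion : (∃ λ xs → ∃ λ ys → ℓ ≡ xs ++ [ k ] ++ ys) → ℓ ∈ perms (suc k)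
  viaDeletion (xs , ys , refl) with deleteMax k xs ys u bound
  ... | u' , bound' =
    ∈-concat⁺′ (∈-insertions k xs ys)
      (∈-map⁺ (insertions k)
        (perms-complete k (xs ++ ys) u' bound' (suc-injective (trans (sym (length-delete xs k ys)) len))))

insertions-unique : ∀ x ℓ {w} → w ∈ insertions x ℓ → All (_< x) ℓ → Unique ℓ → Unique w
insertions-unique x [] (here refl) _ _ = [] ∷ []
insertions-unique x (y ∷ ℓ) (here refl) bound u = All.map (λ y<x x≡y → <-irrefl (sym x≡y) y<x) bound ∷ u
insertions-unique x (y ∷ ℓ) (there w∈) (y<x ∷ bound) (y∉ℓ ∷ u) with ∈-map⁻ (y ∷_) w∈
... | w' , w'∈ , refl = insertions-All x ℓ w'∈ (λ y≡x → <-irrefl y≡x y<x) y∉ℓ ∷ insertions-unique x ℓ w'∈ bound u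

perms-wordUnique : ∀ n {ℓ} → ℓ ∈ perms n → Unique ℓ
perms-wordUnique zero (here refl) = []
perms-wordUnique (suc k) w∈ with ∈-perms-suc w∈
... | ℓ , ℓ∈ , w∈ins = insertions-unique k ℓ w∈ins (proj₂ (perms-shape k ℓ∈)) (perms-wordUnique k ℓ∈)

deleteFirst : ℕ → List ℕ → List ℕ
deleteFirst x [] = []
deleteFirst x (y ∷ ys) = if x ≡ᵇ y then ys else y ∷ deleteFirst x ys

deleteFirst-insertions : ∀ x ℓ {w} → All (_< x) ℓ → w ∈ insertions x ℓ → deleteFirst x w ≡ ℓ
deleteFirst-insertions x [] _ (here refl) rewrite ≡ᵇ-refl x = refl
deleteFirst-insertions x (y ∷ ℓ) _ (here refl) rewrite ≡ᵇ-refl x = refl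
deleteFirst-insertions x (y ∷ ℓ) (y<x ∷ bound) (there w∈) with ∈-map⁻ (y ∷_) w∈
... | w' , w'∈ , refl rewrite ≡ᵇ-false x y (>⇒≢ y<x) = cong (y ∷_) (deleteFirst-insertions x ℓ bound w'∈)

insertions-distinct : ∀ x ℓ → All (_< x) ℓ → Unique (insertions x ℓ)
insertions-distinct x [] _ = [] ∷ []
insertions-distinct x (y ∷ ℓ) (y<x ∷ bound) =
  All.tabulate frontDiffers ∷ Unique.map⁺ ∷-injectiveʳ (insertions-distinct x ℓ bound)
  where
  frontDiffers : ∀ {w} → w ∈ map (y ∷_) (insertions x ℓ) → x ∷ y ∷ ℓ ≢ w
  frontDiffers w∈ e with ∈-map⁻ (y ∷_) w∈
  frontDiffers w∈ refl | w' , _ , refl = <-irrefl refl y<x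

perms-distinct : ∀ n → Unique (perms n)
perms-distinct zero = [] ∷ []
perms-distinct (suc k) =
  unique-concatMap (insertions k) (deleteFirst k) (perms k) (perms-distinct k)
    (λ ℓ ℓ∈ → insertions-distinct k ℓ (proj₂ (perms-shape k ℓ∈)))
    (λ ℓ ℓ∈ w w∈ → deleteFirst-insertions k ℓ (proj₂ (perms-shape k ℓ∈)) w∈)

all-sound : {A : Set} (p : A → Bool) (xs : List A) → all p xs ≡ true → ∀ {x} → x ∈ xs → p x ≡ true
all-sound p xs e x∈ = T⇒≡true (All.lookup (All.all⁺ p xs (≡true⇒T e)) x∈)

all-complete : {A : Set} (p : A → Bool) (xs : List A) → (∀ {x} → x ∈ xs → p x ≡ true) → all p xs ≡ true
all-complete p xs h = T⇒≡true (All.all⁻ p (All.tabulate (≡true⇒T ∘ h)))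

isPermB-sound : ∀ {n} (π : Vec (Fin n) n) → isPermB π ≡ true → IsPerm π
isPermB-sound {n} π e i j πi≡πj =
  toℕ-injective (≡ᵇ-sound _ _ (distinct-or-equal (toℕ i ≡ᵇ toℕ j) _ pair
    (trans (cong (λ z → toℕ (lookup π i) ≡ᵇ toℕ z) (sym πi≡πj)) (≡ᵇ-refl (toℕ (lookup π i))))))
  where
  pair = all-sound _ (allFin n) (all-sound _ (allFin n) e (∈-allFin i)) (∈-allFin j)
  distinct-or-equal : ∀ a b → (a ∨ not b) ≡ true → b ≡ true → a ≡ true
  distinct-or-equal true b _ _ = refl
  distinct-or-equal false true () refl

isPermB-complete : ∀ {n} (π : Vec (Fin n) n) → IsPerm π → isPermB π ≡ true
isPermB-complete {n} π inj =
  all-complete _ (allFin n) (λ {i} _ → all-complete _ (allFin n) (λ {j} _ → pair i j))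
  where
  pair : ∀ i j → ((toℕ i ≡ᵇ toℕ j) ∨ not (toℕ (lookup π i) ≡ᵇ toℕ (lookup π j))) ≡ true
  pair i j with toℕ (lookup π i) ≡ᵇ toℕ (lookup π j) in e
  ... | true rewrite inj i j (toℕ-injective (≡ᵇ-sound _ _ e)) | ≡ᵇ-refl (toℕ j) = refl
  ... | false = ∨-zeroʳ _

-- An injective map of a finite set into itself is onto: otherwise
-- punching out a missed value gives an injection Fin (k + 1) → Fin k.
injective⇒surjective : ∀ {n} (f : Fin n → Fin n) → (∀ i j → f i ≡ f j → i ≡ j) → ∀ y → ∃ λ x → f x ≡ y
injective⇒surjective {suc k} f inj y with any? (λ x → f x Fin.≟ y)
... | yes hit = hit
... | no miss = ⊥-elim (<-irrefl refl (injective⇒≤ punched-injective))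
  where
  punched : Fin (suc k) → Fin k
  punched x = punchOut {i = y} (λ y≡fx → miss (x , sym y≡fx))
  punched-injective : ∀ {x x'} → punched x ≡ punched x' → x ≡ x'
  punched-injective {x} {x'} e = inj x x' (punchOut-injective {i = y} _ _ e)

perm-surjective : ∀ {n} (π : Vec (Fin n) n) → IsPerm π → ∀ i → ∃ λ j → lookup π j ≡ i
perm-surjective π = injective⇒surjective (lookup π)

injective⇒unique : {A : Set} {k : ℕ} (v : Vec A k) → (∀ i j → lookup v i ≡ lookup v j → i ≡ j) → Unique (toList v)
injective⇒unique []ᵥ _ = []
injective⇒unique (x ∷ᵥ v) inj =
  All.tabulate headFresh ∷ injective⇒unique v (λ i j e → Fin.suc-injective (inj (fsuc i) (fsuc j) e))
  where
  headFresh : ∀ {y} → y ∈ toList v → x ≢ y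
  headFresh y∈ x≡y with inj fzero (fsuc (VecAny.index (∈-toList⁻ y∈)))
                             (trans x≡y (lookup-index (∈-toList⁻ y∈)))
  ... | ()

unique⇒injective : {A : Set} {k : ℕ} (v : Vec A k) → Unique (toList v) → (∀ i j → lookup v i ≡ lookup v j → i ≡ j)
unique⇒injective (x ∷ᵥ v) _ fzero fzero _ = refl
unique⇒injective (x ∷ᵥ v) (x∉ ∷ _) fzero (fsuc j) e = ⊥-elim (All.lookup x∉ (∈-toList⁺ (∈-lookup j v)) e)
unique⇒injective (x ∷ᵥ v) (x∉ ∷ _) (fsuc i) fzero e = ⊥-elim (All.lookup x∉ (∈-toList⁺ (∈-lookup i v)) (sym e))
unique⇒injective (x ∷ᵥ v) (_ ∷ u) (fsuc i) (fsuc j) e = cong fsuc (unique⇒injective v u i j e)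

word : ∀ {n} → Vec (Fin n) n → List ℕ
word π = map toℕ (toList π)

word-injective : ∀ {n} {π π' : Vec (Fin n) n} → word π ≡ word π' → π ≡ π'
word-injective {π = π} {π'} e =
  trans (sym (Vec.cast-is-id refl π)) (Vec.toList-injective refl π π' (map-injective toℕ-injective e))

word-length : ∀ {n} (π : Vec (Fin n) n) → length (word π) ≡ n
word-length π = trans (length-map toℕ (toList π)) (Vec.length-toList π)

word-bound : ∀ {n} (π : Vec (Fin n) n) → All (_< n) (word π)
word-bound π = All.map⁺ (All.tabulate (λ {i} _ → toℕ<n i))

isPermB⇔unique-word : ∀ {n} (π : Vec (Fin n) n) → (isPermB π ≡ true → Unique (word π)) × (Unique (word π) → isPermB π ≡ true)
isPermB⇔unique-word π =
  (λ e → Unique.map⁺ toℕ-injective (injective⇒unique π (isPermB-sound π e))) ,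
  (λ u → isPermB-complete π (unique⇒injective π (Unique.map⁻ u)))

fromWord : ∀ {n} (w : List ℕ) → All (_< n) w → Vec (Fin n) (length w)
fromWord [] [] = []ᵥ
fromWord (x ∷ w) (x<n ∷ bound) = fromℕ< x<n ∷ᵥ fromWord w bound

fromWord-word : ∀ {n} (w : List ℕ) (bound : All (_< n) w) → map toℕ (toList (fromWord w bound)) ≡ w
fromWord-word [] [] = refl
fromWord-word (x ∷ w) (x<n ∷ bound) = cong₂ _∷_ (toℕ-fromℕ< x<n) (fromWord-word w bound)

word-surjective : ∀ {n} (w : List ℕ) → All (_< n) w → length w ≡ n → ∃ λ (π : Vec (Fin n) n) → word π ≡ w
word-surjective w bound refl = fromWord w bound , fromWord-word w bound

vecsOver-complete : {A : Set} (L : List A) → (∀ x → x ∈ L) → ∀ {k} (v : Vec A k) → v ∈ vecsOver L k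
vecsOver-complete L all∈ []ᵥ = here refl
vecsOver-complete L all∈ (x ∷ᵥ v) =
  ∈-concat⁺′ (∈-map⁺ (x ∷ᵥ_) (vecsOver-complete L all∈ v)) (∈-map⁺ _ (all∈ x))

vecsOver-distinct : {A : Set} (L : List A) → Unique L → ∀ k → Unique (vecsOver L k)
vecsOver-distinct L uL zero = [] ∷ []
vecsOver-distinct L uL (suc k) =
  unique-concatMap (λ x → map (x ∷ᵥ_) (vecsOver L k)) head L uL
    (λ x _ → Unique.map⁺ Vec.∷-injectiveʳ (vecsOver-distinct L uL k))
    (λ x _ z z∈ → headOf x z∈)
  where
  headOf : ∀ x {z} → z ∈ map (x ∷ᵥ_) (vecsOver L k) → head z ≡ x
  headOf x z∈ with ∈-map⁻ (x ∷ᵥ_) z∈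
  ... | w , _ , refl = refl

permWords : ℕ → List (List ℕ)
permWords n = map word (filterᵇ isPermB (vecsOver (allFin n) n))

permWords↭perms : ∀ n → permWords n ↭ perms n
permWords↭perms n = sameElements⇒↭ distinct (perms-distinct n) ⊆perms perms⊆
  where
  distinct : Unique (permWords n)
  distinct = Unique.map⁺ word-injective (Unique.filter⁺ (T? ∘ isPermB) (vecsOver-distinct (allFin n) (Unique.allFin⁺ n) n))
  ⊆perms : ∀ {w} → w ∈ permWords n → w ∈ perms n
  ⊆perms w∈ with ∈-map⁻ word w∈
  ... | π , π∈ , refl with ∈-filter⁻ (T? ∘ isPermB) {xs = vecsOver (allFin n) n} π∈
  ... | _ , isPerm =
    perms-complete n (word π) (proj₁ (isPermB⇔unique-word π) (T⇒≡true isPerm)) (word-bound π) (word-length π)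
  perms⊆ : ∀ {w} → w ∈ perms n → w ∈ permWords n
  perms⊆ {w} w∈ with perms-shape n w∈
  ... | len , bound with word-surjective w bound len
  ... | π , refl =
    ∈-map⁺ word (∈-filter⁺ (T? ∘ isPermB) (vecsOver-complete (allFin n) ∈-allFin π)
      (≡true⇒T (proj₂ (isPermB⇔unique-word π) (perms-wordUnique n w∈))))

∑-permVectors : ∀ n (f : List ℕ → ℕ) →
  ∑ (λ π → if isPermB π then f (word π) else 0) (vecsOver (allFin n) n) ≡ ∑ f (perms n)
∑-permVectors n f =
  trans (∑-filter isPermB (f ∘ word) (vecsOver (allFin n) n))
        (trans (sym (∑-map f word (filterᵇ isPermB (vecsOver (allFin n) n))))
               (∑-↭ f (permWords↭perms n)))

countB-cong : {A : Set} {p q : A → Bool} (xs : List A) → (∀ x → x ∈ xs → p x ≡ q x) → countB p xs ≡ countB q xs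
countB-cong {p = p} {q} xs h = trans (countB≡∑ p xs) (trans (∑-cong xs (λ x x∈ → cong 𝟙 (h x x∈))) (sym (countB≡∑ q xs)))

countB-map : {A B : Set} (p : B → Bool) (f : A → B) (xs : List A) → countB p (map f xs) ≡ countB (p ∘ f) xs
countB-map p f [] = refl
countB-map p f (x ∷ xs) = cong (𝟙 (p (f x)) +_) (countB-map p f xs)

countB-none : {A : Set} (p : A → Bool) (xs : List A) → (∀ x → x ∈ xs → p x ≡ false) → countB p xs ≡ 0
countB-none p xs h = trans (countB≡∑ p xs) (∑-zero (𝟙 ∘ p) xs (λ x x∈ → cong 𝟙 (h x x∈)))

countB-∨ : {A : Set} (p q : A → Bool) (xs : List A) → (∀ x → (p x ∧ q x) ≡ false) →
  countB (λ x → p x ∨ q x) xs ≡ countB p xs + countB q xs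
countB-∨ p q [] _ = refl
countB-∨ p q (x ∷ xs) excl with p x in px | q x in qx
... | true | true with () ← trans (sym (cong₂ _∧_ px qx)) (excl x)
... | true | false = cong suc (countB-∨ p q xs excl)
... | false | true = trans (cong suc (countB-∨ p q xs excl)) (sym (+-suc _ _))
... | false | false = countB-∨ p q xs excl

countB-upTo : ∀ p K → countB (λ a → a ≡ᵇ p) (upTo K) ≡ 𝟙 (p <ᵇ K)
countB-upTo p K with p <? K
... | yes p<K rewrite <ᵇ-true p<K =
  trans (countB≡∑ _ (upTo K))
        (trans (∑-cong (upTo K) (λ a _ → trans (cong 𝟙 (≡ᵇ-sym a p)) (sym (*-identityˡ _))))
               (∑-pick (λ _ → 1) p K p<K))
... | no p≮K rewrite <ᵇ-false p≮K =
  countB-none _ (upTo K) (λ a a∈ → ≡ᵇ-false a p (λ a≡p → p≮K (subst (_< K) a≡p (∈-upTo⁻ a∈))))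

∏ᶠ : (n : ℕ) → (Fin n → ℕ) → ℕ
∏ᶠ zero f = 1
∏ᶠ (suc n) f = f fzero * ∏ᶠ n (f ∘ fsuc)

∏ᶠ-cong : ∀ n {f g : Fin n → ℕ} → (∀ i → f i ≡ g i) → ∏ᶠ n f ≡ ∏ᶠ n g
∏ᶠ-cong zero _ = refl
∏ᶠ-cong (suc n) h = cong₂ _*_ (h fzero) (∏ᶠ-cong n (h ∘ fsuc))

product-tabulate : ∀ {A : Set} n (f : A → ℕ) (g : Fin n → A) → product (map f (tabulate g)) ≡ ∏ᶠ n (f ∘ g)
product-tabulate zero f g = refl
product-tabulate (suc n) f g = cong (f (g fzero) *_) (product-tabulate n f (g ∘ fsuc))

∏ᶠ-reindex : ∀ n (f : Fin n → ℕ) (σ : Fin n → Fin n) → (∀ i j → σ i ≡ σ j → i ≡ j) →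
  ∏ᶠ n (f ∘ σ) ≡ ∏ᶠ n f
∏ᶠ-reindex n f σ inj =
  begin
    ∏ᶠ n (f ∘ σ)
  ≡⟨ sym (product-tabulate n f σ) ⟩
    product (map f (tabulate σ))
  ≡⟨ cong (product ∘ map f) (sym (map-tabulate (λ i → i) σ)) ⟩
    product (map f (map σ (allFin n)))
  ≡⟨ product-↭ (Perm.map⁺ f image↭allFin) ⟩
    product (map f (allFin n))
  ≡⟨ product-tabulate n f (λ i → i) ⟩
    ∏ᶠ n f
  ∎
  where
  open ≡-Reasoning
  image↭allFin = sameElements⇒↭ (Unique.map⁺ (inj _ _) (Unique.allFin⁺ n)) (Unique.allFin⁺ n)
    (λ _ → ∈-allFin _)
    (λ {j} _ → let (i , σi≡j) = injective⇒surjective σ inj j in subst (_∈ _) σi≡j (∈-map⁺ σ (∈-allFin i)))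

allᶠ : (n : ℕ) → (Fin n → Bool) → Bool
allᶠ zero h = true
allᶠ (suc n) h = h fzero ∧ allᶠ n (h ∘ fsuc)

all-tabulate : ∀ {A : Set} n (q : A → Bool) (g : Fin n → A) → all q (tabulate g) ≡ allᶠ n (q ∘ g)
all-tabulate zero q g = refl
all-tabulate (suc n) q g = cong (q (g fzero) ∧_) (all-tabulate n q (g ∘ fsuc))

countB-vecsOver : ∀ {A : Set} n (L : List A) (G : Fin n → A → Bool) →
  countB (λ C → allᶠ n (λ i → G i (lookup C i))) (vecsOver L n) ≡ ∏ᶠ n (λ i → countB (G i) L)
countB-vecsOver zero L G = refl
countB-vecsOver (suc n) L G =
  begin
    countB (λ C → allᶠ (suc n) (λ i → G i (lookup C i))) (vecsOver L (suc n))
  ≡⟨ countB≡∑ _ (vecsOver L (suc n)) ⟩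
    ∑ (λ C → 𝟙 (allᶠ (suc n) (λ i → G i (lookup C i)))) (concatMap (λ x → map (x ∷ᵥ_) (vecsOver L n)) L)
  ≡⟨ ∑-concatMap _ (λ x → map (x ∷ᵥ_) (vecsOver L n)) L ⟩
    ∑ (λ x → ∑ (λ C → 𝟙 (allᶠ (suc n) (λ i → G i (lookup C i)))) (map (x ∷ᵥ_) (vecsOver L n))) L
  ≡⟨ ∑-cong L (λ x _ → trans (∑-map _ (x ∷ᵥ_) (vecsOver L n)) (firstEntry x)) ⟩
    ∑ (λ x → 𝟙 (G fzero x) * rest) L
  ≡⟨ ∑-*ʳ (𝟙 ∘ G fzero) rest L ⟩
    ∑ (𝟙 ∘ G fzero) L * rest
  ≡⟨ cong (_* rest) (sym (countB≡∑ (G fzero) L)) ⟩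
    countB (G fzero) L * rest
  ∎
  where
  open ≡-Reasoning
  rest : ℕ
  rest = ∏ᶠ n (λ i → countB (G (fsuc i)) L)
  firstEntry : ∀ x → ∑ (λ C → 𝟙 (G fzero x ∧ allᶠ n (λ i → G (fsuc i) (lookup C i)))) (vecsOver L n)
                       ≡ 𝟙 (G fzero x) * rest
  firstEntry x with G fzero x
  ... | true = trans (sym (countB≡∑ _ (vecsOver L n))) (trans (countB-vecsOver n L (G ∘ fsuc)) (sym (+-identityʳ _)))
  ... | false = ∑-zero _ (vecsOver L n) (λ _ _ → refl)

posOf-lookup : ∀ {n} (π : Vec (Fin n) n) → IsPerm π → ∀ {i} j → lookup π j ≡ i → posOf π i ≡ suc (toℕ j)
posOf-lookup {n} π inj {i} j πj≡i = scan (allFin n) (∈-allFin j)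
  where
  scan : ∀ js → j ∈ js →
    Data.List.foldr (λ j' acc → if toℕ (lookup π j') ≡ᵇ toℕ i then suc (toℕ j') else acc) 0 js ≡ suc (toℕ j)
  scan (j' ∷ js) j∈ with toℕ (lookup π j') ≡ᵇ toℕ i in eq
  ... | true = cong (suc ∘ toℕ) (inj j' j (trans (toℕ-injective (≡ᵇ-sound _ _ eq)) (sym πj≡i)))
  scan (j' ∷ js) (here refl) | false rewrite πj≡i | ≡ᵇ-refl (toℕ i) with () ← eq
  scan (j' ∷ js) (there j∈) | false = scan js j∈

taken-before : ∀ {n} (π : Vec (Fin n) n) → IsPerm π → ∀ j' i →
  memB (suc (toℕ j')) (earlier π i) ≡ (toℕ (lookup π j') <ᵇ toℕ i)
taken-before {n} π inj j' i with toℕ (lookup π j') <ᵇ toℕ i in lt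
... | true = memB-complete _ _ (subst (_∈ earlier π i) (posOf-lookup π inj j' refl)
               (∈-map⁺ (posOf π) (∈-filter⁺ _ (∈-allFin (lookup π j')) (≡true⇒T lt))))
... | false = memB-false _ _ notEarlier
  where
  notEarlier : ¬ (suc (toℕ j') ∈ earlier π i)
  notEarlier j'∈ with ∈-map⁻ (posOf π) j'∈
  ... | i' , i'∈ , e with ∈-filter⁻ _ {xs = allFin n} i'∈ | perm-surjective π inj i'
  ... | _ , i'<i | j'' , refl with toℕ-injective (suc-injective (trans e (posOf-lookup π inj j'' refl)))
  ... | refl with () ← trans (sym (T⇒≡true i'<i)) lt

filterᵇ-cons : (q : ℕ → Bool) (x : ℕ) (xs : List ℕ) →
  filterᵇ q (x ∷ xs) ≡ (if q x then x ∷ filterᵇ q xs else filterᵇ q xs)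
filterᵇ-cons q x xs with q x
... | true = refl
... | false = refl

filterᵇ-pair : (q : ℕ → Bool) (a b : ℕ) → filterᵇ q (a ∷ b ∷ []) ≡
  (if q a then a ∷ (if q b then b ∷ [] else []) else (if q b then b ∷ [] else []))
filterᵇ-pair q a b rewrite filterᵇ-cons q a (b ∷ []) | filterᵇ-cons q b [] = refl

parksAt-free : ∀ (free : ℕ → Bool) P a → free P ≡ true →
  isSmallest P (filterᵇ free (interval2 a)) ≡ (a ≡ᵇ P) ∨ ((suc a ≡ᵇ P) ∧ not (free a))
parksAt-free free P a freeP rewrite filterᵇ-pair free a (suc a) with a ≟ P
parksAt-free free P a freeP | yes refl rewrite freeP with free (suc a)
... | false rewrite ≡ᵇ-refl a | ≤ᵇ-true (≤-refl {a}) = refl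
... | true rewrite ≡ᵇ-refl a | ≤ᵇ-true (≤-refl {a}) | ≤ᵇ-true (n≤1+n a) = refl
parksAt-free free P a freeP | no a≢P with suc a ≟ P
parksAt-free free P a freeP | no a≢P | yes refl rewrite freeP with free a
... | false rewrite ≡ᵇ-false a (suc a) a≢P | ≡ᵇ-refl a | <ᵇ-true (n<1+n a) = refl
... | true rewrite ≡ᵇ-false a (suc a) a≢P | ≡ᵇ-refl a | ≡ᵇ-false (suc a) a (a≢P ∘ sym)
                 | <ᵇ-false {a} {a} (<-irrefl refl) = refl
parksAt-free free P a freeP | no a≢P | no a+1≢P
  rewrite ≡ᵇ-false a P a≢P | ≡ᵇ-false (suc a) P a+1≢P with free a | free (suc a)
... | true | true rewrite ≡ᵇ-false P a (a≢P ∘ sym) | ≡ᵇ-false P (suc a) (a+1≢P ∘ sym) = refl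
... | true | false rewrite ≡ᵇ-false P a (a≢P ∘ sym) = refl
... | false | true rewrite ≡ᵇ-false P (suc a) (a+1≢P ∘ sym) = refl
... | false | false = refl

parksCorrectly : ∀ {n} → Vec (Fin n) n → Fin n → ℕ → Bool
parksCorrectly π i a = isSmallest (posOf π i) (filterᵇ (λ c → not (memB c (earlier π i))) (interval2 a))

parksCorrectly-at : ∀ {n} (π : Vec (Fin n) n) → IsPerm π → ∀ j a →
  parksCorrectly π (lookup π j) a ≡ (a ≡ᵇ suc (toℕ j)) ∨ ((suc a ≡ᵇ suc (toℕ j)) ∧ memB a (earlier π (lookup π j)))
parksCorrectly-at π inj j a =
  begin
    isSmallest (posOf π i) (filterᵇ free (interval2 a))
  ≡⟨ cong (λ P → isSmallest P (filterᵇ free (interval2 a))) (posOf-lookup π inj j refl) ⟩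
    isSmallest (suc (toℕ j)) (filterᵇ free (interval2 a))
  ≡⟨ parksAt-free free (suc (toℕ j)) a targetFree ⟩
    (a ≡ᵇ suc (toℕ j)) ∨ ((suc a ≡ᵇ suc (toℕ j)) ∧ not (not (memB a E)))
  ≡⟨ cong (λ b → (a ≡ᵇ suc (toℕ j)) ∨ ((suc a ≡ᵇ suc (toℕ j)) ∧ b)) (not-involutive (memB a E)) ⟩
    (a ≡ᵇ suc (toℕ j)) ∨ ((suc a ≡ᵇ suc (toℕ j)) ∧ memB a E)
  ∎
  where
  open ≡-Reasoning
  i = lookup π j
  E = earlier π i
  free : ℕ → Bool
  free c = not (memB c E)
  targetFree : free (suc (toℕ j)) ≡ true
  targetFree = cong not (trans (taken-before π inj j i) (<ᵇ-false {toℕ i} {toℕ i} (<-irrefl refl)))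

ascentBefore : ∀ {n} → Vec (Fin n) n → Fin n → ℕ
ascentBefore π fzero = 0
ascentBefore π (fsuc j) = 𝟙 (toℕ (lookup π (inject₁ j)) <ᵇ toℕ (lookup π (fsuc j)))

-- The number of preferences {a, a+1} ⊆ [n] with which the car parked at
-- spot j+1 parks correctly: [j+1 < n] + [j > 0 and π_{j-1} < π_j].
spotWeight : ∀ {n} → Vec (Fin n) n → Fin n → ℕ
spotWeight {n} π j = 𝟙 (toℕ j <ᵇ n ∸ 1) + ascentBefore π j

countB-precedingAscent : ∀ {n} (π : Vec (Fin n) n) → IsPerm π → ∀ j →
  countB (λ a → (suc a ≡ᵇ toℕ j) ∧ memB (suc a) (earlier π (lookup π j))) (upTo (n ∸ 1)) ≡ ascentBefore π j
countB-precedingAscent {n} π inj fzero = countB-none _ (upTo (n ∸ 1)) (λ a _ → refl)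
countB-precedingAscent {suc n} π inj (fsuc j') =
  begin
    countB (λ a → (a ≡ᵇ toℕ j') ∧ memB (suc a) E) (upTo n)
  ≡⟨ countB-cong (upTo n) (λ a _ → atPredecessor a) ⟩
    countB (λ a → (a ≡ᵇ toℕ j') ∧ memB (suc (toℕ j')) E) (upTo n)
  ≡⟨ onlyPredecessor (memB (suc (toℕ j')) E) ⟩
    𝟙 (memB (suc (toℕ j')) E)
  ≡⟨ cong (λ z → 𝟙 (memB (suc z) E)) (sym (toℕ-inject₁ j')) ⟩
    𝟙 (memB (suc (toℕ (inject₁ j'))) E)
  ≡⟨ cong 𝟙 (taken-before π inj (inject₁ j') (lookup π (fsuc j'))) ⟩
    ascentBefore π (fsuc j')
  ∎
  where
  open ≡-Reasoning
  E = earlier π (lookup π (fsuc j'))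
  atPredecessor : ∀ a → ((a ≡ᵇ toℕ j') ∧ memB (suc a) E) ≡ ((a ≡ᵇ toℕ j') ∧ memB (suc (toℕ j')) E)
  atPredecessor a with a ≡ᵇ toℕ j' in e
  ... | false = refl
  ... | true = cong (λ z → memB (suc z) E) (≡ᵇ-sound a (toℕ j') e)
  onlyPredecessor : ∀ b → countB (λ a → (a ≡ᵇ toℕ j') ∧ b) (upTo n) ≡ 𝟙 b
  onlyPredecessor false = countB-none _ (upTo n) (λ a _ → ∧-zeroʳ _)
  onlyPredecessor true =
    trans (countB-cong (upTo n) (λ a _ → ∧-identityʳ _))
          (trans (countB-upTo (toℕ j') n) (cong 𝟙 (<ᵇ-true (≤-pred (toℕ<n (fsuc j'))))))

carChoices : ∀ {n} (π : Vec (Fin n) n) → IsPerm π → ∀ j →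
  countB (parksCorrectly π (lookup π j)) (starts n) ≡ spotWeight π j
carChoices {n} π inj j =
  begin
    countB (parksCorrectly π (lookup π j)) (map suc (upTo (n ∸ 1)))
  ≡⟨ countB-map _ suc (upTo (n ∸ 1)) ⟩
    countB (parksCorrectly π (lookup π j) ∘ suc) (upTo (n ∸ 1))
  ≡⟨ countB-cong (upTo (n ∸ 1)) (λ a _ → parksCorrectly-at π inj j (suc a)) ⟩
    countB (λ a → (a ≡ᵇ toℕ j) ∨ ((suc a ≡ᵇ toℕ j) ∧ memB (suc a) E)) (upTo (n ∸ 1))
  ≡⟨ countB-∨ _ _ (upTo (n ∸ 1)) (λ a → exclusive a (toℕ j) (memB (suc a) E)) ⟩
    countB (λ a → a ≡ᵇ toℕ j) (upTo (n ∸ 1)) + countB (λ a → (suc a ≡ᵇ toℕ j) ∧ memB (suc a) E) (upTo (n ∸ 1))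
  ≡⟨ cong₂ _+_ (countB-upTo (toℕ j) (n ∸ 1)) (countB-precedingAscent π inj j) ⟩
    spotWeight π j
  ∎
  where
  open ≡-Reasoning
  E = earlier π (lookup π j)
  exclusive : ∀ a b c → ((a ≡ᵇ b) ∧ ((suc a ≡ᵇ b) ∧ c)) ≡ false
  exclusive zero zero c = refl
  exclusive zero (suc b) c = refl
  exclusive (suc a) zero c = refl
  exclusive (suc a) (suc b) c = exclusive a b c

-- IPF₂(n, π) is the product of the spot weights: by the product principle
-- it is the product over cars i of their numbers of admissible
-- preferences, and reindexing by the spot of car i gives the spot weights.
IPF2-product : ∀ {n} (π : Vec (Fin n) n) → IsPerm π → IPF2 n π ≡ ∏ᶠ n (spotWeight π)
IPF2-product {n} π inj =
  begin
    countB (hasOutcome π) (tuples2 n)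
  ≡⟨ countB-cong (tuples2 n) (λ C _ → all-tabulate n (λ i → parksCorrectly π i (lookup C i)) (λ i → i)) ⟩
    countB (λ C → allᶠ n (λ i → parksCorrectly π i (lookup C i))) (vecsOver (starts n) n)
  ≡⟨ countB-vecsOver n (starts n) (parksCorrectly π) ⟩
    ∏ᶠ n (λ i → countB (parksCorrectly π i) (starts n))
  ≡⟨ ∏ᶠ-cong n (λ i → trans (cong (λ z → countB (parksCorrectly π z) (starts n)) (sym (proj₂ (perm-surjective π inj i))))
                            (carChoices π inj (spot i))) ⟩
    ∏ᶠ n (spotWeight π ∘ spot)
  ≡⟨ ∏ᶠ-reindex n (spotWeight π) spot spot-injective ⟩
    ∏ᶠ n (spotWeight π)
  ∎
  where
  open ≡-Reasoning
  spot : Fin n → Fin n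
  spot i = proj₁ (perm-surjective π inj i)
  spot-injective : ∀ i i' → spot i ≡ spot i' → i ≡ i'
  spot-injective i i' e =
    trans (sym (proj₂ (perm-surjective π inj i))) (trans (cong (lookup π) e) (proj₂ (perm-surjective π inj i')))

spotsProduct : ℕ → List ℕ → ℕ
spotsProduct p [] = 1
spotsProduct p (y ∷ []) = 𝟙 (p <ᵇ y)
spotsProduct p (y ∷ z ∷ r) = (1 + 𝟙 (p <ᵇ y)) * spotsProduct y (z ∷ r)

spotWeightAfter : ∀ {N K} → Fin N → Vec (Fin N) K → Fin K → ℕ
spotWeightAfter {K = K} p u j = 𝟙 (suc (toℕ j) <ᵇ K) + 𝟙 (toℕ (lookup (p ∷ᵥ u) (inject₁ j)) <ᵇ toℕ (lookup u j))

∏-spotWeightAfter : ∀ {N K} (p : Fin N) (u : Vec (Fin N) (suc K)) →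
  ∏ᶠ (suc K) (spotWeightAfter p u) ≡ spotsProduct (toℕ p) (map toℕ (toList u))
∏-spotWeightAfter p (y ∷ᵥ []ᵥ) = *-identityʳ _
∏-spotWeightAfter p (y ∷ᵥ z ∷ᵥ u) = cong ((1 + 𝟙 (toℕ p <ᵇ toℕ y)) *_) (∏-spotWeightAfter y (z ∷ᵥ u))

pow2 : ℕ → ℕ
pow2 a = 2 ^ (a ∸ 1)

-- The spot weights multiply to 2^{asc-1} if the word ends with an ascent
-- and to 0 otherwise: the first spot weighs 1, the last one [ascent], and
-- every other spot 2 or 1 according to whether it follows an ascent.
spotsProduct≡lastAscentWeight : ∀ x y r → spotsProduct x (y ∷ r) ≡ lastAscentWeight pow2 (x ∷ y ∷ r)
spotsProduct≡lastAscentWeight x y [] with x <ᵇ y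
... | true = refl
... | false = refl
spotsProduct≡lastAscentWeight x y (z ∷ r) rewrite spotsProduct≡lastAscentWeight y z r
  with endsWithAscent (y ∷ z ∷ r) in ends
... | false = *-zeroʳ (1 + 𝟙 (x <ᵇ y))
... | true = doubling (ascL (y ∷ z ∷ r)) (endsWithAscent⇒asc≥1 (y ∷ z ∷ r) ends)
  where
  doubling : ∀ a → 1 ≤ a → (1 + 𝟙 (x <ᵇ y)) * 2 ^ (a ∸ 1) ≡ 2 ^ (𝟙 (x <ᵇ y) + a ∸ 1)
  doubling (suc a) _ with x <ᵇ y
  ... | true = refl
  ... | false = +-identityʳ _

IPF2≡lastAscentWeight : ∀ m (π : Vec (Fin (suc (suc m))) (suc (suc m))) → IsPerm π →
  IPF2 (suc (suc m)) π ≡ lastAscentWeight pow2 (word π)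
IPF2≡lastAscentWeight m π@(x ∷ᵥ y ∷ᵥ u) inj =
  trans (IPF2-product π inj)
        (trans (+-identityʳ _)
               (trans (∏-spotWeightAfter x (y ∷ᵥ u))
                      (spotsProduct≡lastAscentWeight (toℕ x) (toℕ y) (map toℕ (toList u)))))

isSmallest-unique : ∀ p q L → isSmallest p L ≡ true → isSmallest q L ≡ true → p ≡ q
isSmallest-unique p q L hp hq = ≤-antisym (below p q hp hq) (below q p hq hp)
  where
  below : ∀ p q → isSmallest p L ≡ true → isSmallest q L ≡ true → p ≤ q
  below p q hp hq =
    ≤ᵇ-sound (all-sound _ L (proj₂ (∧-true hp)) (memB-sound q L (proj₁ (∧-true hq))))

-- A tuple of preferences has at most one outcome: by strong induction on
-- the car label, car i takes the same spot under both outcomes, since the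
-- spots taken before it coincide.
outcome-unique : ∀ {n} (π π' : Vec (Fin n) n) (C : Vec ℕ n) → IsPerm π → IsPerm π' →
  hasOutcome π C ≡ true → hasOutcome π' C ≡ true → π ≡ π'
outcome-unique {n} π π' C inj inj' out out' =
  trans (sym (Vec.tabulate∘lookup π)) (trans (Vec.tabulate-cong sameEntry) (Vec.tabulate∘lookup π'))
  where
  sameSpot : ∀ i → posOf π i ≡ posOf π' i
  sameSpot = WF.All.wfRec <ᶠ-wellFounded 0ℓ (λ i → posOf π i ≡ posOf π' i) step
    where
    step : ∀ i → (∀ {i'} → i' <ᶠ i → posOf π i' ≡ posOf π' i') → posOf π i ≡ posOf π' i
    step i ih = isSmallest-unique _ _ (remaining π C i)
      (all-sound _ (allFin n) out (∈-allFin i))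
      (subst (λ E → isSmallest (posOf π' i) (filterᵇ (λ c → not (memB c E)) (interval2 (lookup C i))) ≡ true)
             (sym sameEarlier) (all-sound _ (allFin n) out' (∈-allFin i)))
      where
      sameEarlier : earlier π i ≡ earlier π' i
      sameEarlier = map-cong-local (All.tabulate (λ i'∈ →
        ih (<ᵇ-sound (T⇒≡true (proj₂ (∈-filter⁻ (λ i' → T? (toℕ i' <ᵇ toℕ i)) {xs = allFin n} i'∈))))))
  sameEntry : ∀ j → lookup π j ≡ lookup π' j
  sameEntry j with perm-surjective π' inj' (lookup π j)
  ... | j' , π'j'≡ with toℕ-injective (suc-injective
         (trans (sym (posOf-lookup π inj j refl)) (trans (sameSpot (lookup π j)) (posOf-lookup π' inj' j' π'j'≡))))
  ... | refl = sym π'j'≡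

𝟙-any : {A : Set} (r : A → Bool) (xs : List A) → Unique xs →
  (∀ x y → x ∈ xs → y ∈ xs → r x ≡ true → r y ≡ true → x ≡ y) → 𝟙 (any r xs) ≡ ∑ (𝟙 ∘ r) xs
𝟙-any r [] _ _ = refl
𝟙-any r (x ∷ xs) (x∉xs ∷ u) atMostOne with r x in rx
... | true = cong suc (sym (∑-zero _ xs noOther))
  where
  noOther : ∀ y → y ∈ xs → 𝟙 (r y) ≡ 0
  noOther y y∈ with r y in ry
  ... | true = ⊥-elim (All.lookup x∉xs y∈ (atMostOne x y (here refl) (there y∈) rx ry))
  ... | false = refl
... | false = 𝟙-any r xs u (λ x y x∈ y∈ → atMostOne x y (there x∈) (there y∈))

-- Since outcomes are unique, IPF₂(n) is the sum of IPF₂(n, π) over the permutations π.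
IPF2total≡∑IPF2 : ∀ n → IPF2total n ≡ ∑ (λ π → if isPermB π then IPF2 n π else 0) (vecsOver (allFin n) n)
IPF2total≡∑IPF2 n =
  begin
    countB (λ C → any (parkingOutcome C) Vs) (tuples2 n)
  ≡⟨ countB≡∑ _ (tuples2 n) ⟩
    ∑ (λ C → 𝟙 (any (parkingOutcome C) Vs)) (tuples2 n)
  ≡⟨ ∑-cong (tuples2 n) (λ C _ → 𝟙-any _ Vs (vecsOver-distinct (allFin n) (Unique.allFin⁺ n) n) (atMostOne C)) ⟩
    ∑ (λ C → ∑ (λ π → 𝟙 (parkingOutcome C π)) Vs) (tuples2 n)
  ≡⟨ ∑-swap (λ C π → 𝟙 (parkingOutcome C π)) (tuples2 n) Vs ⟩
    ∑ (λ π → ∑ (λ C → 𝟙 (parkingOutcome C π)) (tuples2 n)) Vs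
  ≡⟨ ∑-cong Vs (λ π _ → perPermutation π) ⟩
    ∑ (λ π → if isPermB π then IPF2 n π else 0) Vs
  ∎
  where
  open ≡-Reasoning
  Vs = vecsOver (allFin n) n
  parkingOutcome : Vec ℕ n → Vec (Fin n) n → Bool
  parkingOutcome C π = isPermB π ∧ hasOutcome π C
  atMostOne : ∀ C π π' → π ∈ Vs → π' ∈ Vs → parkingOutcome C π ≡ true → parkingOutcome C π' ≡ true → π ≡ π'
  atMostOne C π π' _ _ h h' with ∧-true h | ∧-true h'
  ... | perm , out | perm' , out' = outcome-unique π π' C (isPermB-sound π perm) (isPermB-sound π' perm') out out'
  perPermutation : ∀ π → ∑ (λ C → 𝟙 (parkingOutcome C π)) (tuples2 n) ≡ (if isPermB π then IPF2 n π else 0)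
  perPermutation π with isPermB π
  ... | true = sym (countB≡∑ (hasOutcome π) (tuples2 n))
  ... | false = ∑-zero _ (tuples2 n) (λ _ _ → refl)

eulerian≡countB-perms : ∀ M j → eulerian M j ≡ countB (λ ℓ → ascL ℓ ≡ᵇ j) (perms M)
eulerian≡countB-perms M j =
  begin
    countB (λ π → isPermB π ∧ (asc π ≡ᵇ j)) (vecsOver (allFin M) M)
  ≡⟨ countB≡∑ _ (vecsOver (allFin M) M) ⟩
    ∑ (λ π → 𝟙 (isPermB π ∧ (asc π ≡ᵇ j))) (vecsOver (allFin M) M)
  ≡⟨ ∑-cong (vecsOver (allFin M) M) (λ π _ → ifPerm π) ⟩
    ∑ (λ π → if isPermB π then 𝟙 (ascL (word π) ≡ᵇ j) else 0) (vecsOver (allFin M) M)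
  ≡⟨ ∑-permVectors M (λ ℓ → 𝟙 (ascL ℓ ≡ᵇ j)) ⟩
    ∑ (λ ℓ → 𝟙 (ascL ℓ ≡ᵇ j)) (perms M)
  ≡⟨ sym (countB≡∑ _ (perms M)) ⟩
    countB (λ ℓ → ascL ℓ ≡ᵇ j) (perms M)
  ∎
  where
  open ≡-Reasoning
  ifPerm : ∀ π → 𝟙 (isPermB π ∧ (asc π ≡ᵇ j)) ≡ (if isPermB π then 𝟙 (ascL (word π) ≡ᵇ j) else 0)
  ifPerm π with isPermB π
  ... | true = refl
  ... | false = refl

-- The right-hand side of the corollary, regrouped over the permutations σ
-- of {0,…,m}: the term k = asc σ + 1 collects the (n - k)·2^{k-1}
-- = (1 + des σ)·2^{asc σ} contributed by each σ with asc σ = k - 1.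
eulerSum≡∑perms : ∀ m → eulerSum (suc (suc m)) ≡ ∑ (λ ℓ → suc (des ℓ) * 2 ^ ascL ℓ) (perms (suc m))
eulerSum≡∑perms m =
  begin
    ∑ (λ k → (n ∸ k) * eulerian M (k ∸ 1) * 2 ^ (k ∸ 1)) (map suc (upTo M))
  ≡⟨ ∑-map _ suc (upTo M) ⟩
    ∑ (λ j → (M ∸ j) * eulerian M j * 2 ^ j) (upTo M)
  ≡⟨ ∑-cong (upTo M) (λ j _ → countPerms j) ⟩
    ∑ (λ j → weight j * countB (λ ℓ → ascL ℓ ≡ᵇ j) (perms M)) (upTo M)
  ≡⟨ sym (∑-byValue ascL weight M (perms M) (λ ℓ ℓ∈ → s≤s (asc-perms m ℓ∈))) ⟩
    ∑ (weight ∘ ascL) (perms M)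
  ≡⟨ ∑-cong (perms M) (λ ℓ ℓ∈ → cong (_* 2 ^ ascL ℓ) (sym (des+1 ℓ ℓ∈))) ⟩
    ∑ (λ ℓ → suc (des ℓ) * 2 ^ ascL ℓ) (perms M)
  ∎
  where
  open ≡-Reasoning
  n = suc (suc m)
  M = suc m
  weight : ℕ → ℕ
  weight a = (M ∸ a) * 2 ^ a
  countPerms : ∀ j → (M ∸ j) * eulerian M j * 2 ^ j ≡ weight j * countB (λ ℓ → ascL ℓ ≡ᵇ j) (perms M)
  countPerms j rewrite eulerian≡countB-perms M j = reorder (M ∸ j) (countB (λ ℓ → ascL ℓ ≡ᵇ j) (perms M)) (2 ^ j)
    where
    reorder : ∀ a b c → a * b * c ≡ a * c * b
    reorder = solve-∀
  des+1 : ∀ ℓ → ℓ ∈ perms M → suc (des ℓ) ≡ M ∸ ascL ℓ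
  des+1 ℓ ℓ∈ = trans (cong suc (des-perms m ℓ∈)) (sym (+-∸-assoc 1 (asc-perms m ℓ∈)))

IPF2total≡lastAscentSum : ∀ m → IPF2total (suc (suc m)) ≡ ∑ (lastAscentWeight pow2) (perms (suc (suc m)))
IPF2total≡lastAscentSum m =
  trans (IPF2total≡∑IPF2 n)
        (trans (∑-cong (vecsOver (allFin n) n) (λ π _ → perPermutation π)) (∑-permVectors n (lastAscentWeight pow2)))
  where
  n = suc (suc m)
  perPermutation : ∀ π → (if isPermB π then IPF2 n π else 0) ≡ (if isPermB π then lastAscentWeight pow2 (word π) else 0)
  perPermutation π with isPermB π in perm
  ... | true = IPF2≡lastAscentWeight m π (isPermB-sound π perm)
  ... | false = refl

endsWithAscent-word : ∀ {N} m (v : Vec (Fin N) (suc (suc m))) →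
  endsWithAscent (map toℕ (toList v)) ≡ (toℕ (lookup v (inject₁ (fromℕ m))) <ᵇ toℕ (lookup v (fromℕ (suc m))))
endsWithAscent-word zero (a ∷ᵥ b ∷ᵥ []ᵥ) = refl
endsWithAscent-word (suc m) (a ∷ᵥ b ∷ᵥ c ∷ᵥ w) = endsWithAscent-word m (b ∷ᵥ c ∷ᵥ w)

corollary1p6 : (m : ℕ) →
    ((π : Vec (Fin (suc (suc m))) (suc (suc m))) → IsPerm π →
      lookup π (inject₁ (fromℕ m)) <ᶠ lookup π (fromℕ (suc m)) →
      IPF2 (suc (suc m)) π ≡ 2 ^ (asc π ∸ 1))
    × IPF2total (suc (suc m)) ≡ eulerSum (suc (suc m))
corollary1p6 m = perPermutation , total
  where
  perPermutation : (π : Vec (Fin (suc (suc m))) (suc (suc m))) → IsPerm π →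
    lookup π (inject₁ (fromℕ m)) <ᶠ lookup π (fromℕ (suc m)) → IPF2 (suc (suc m)) π ≡ 2 ^ (asc π ∸ 1)
  perPermutation π inj lastAscent
    rewrite IPF2≡lastAscentWeight m π inj | endsWithAscent-word m π | <ᵇ-true lastAscent = refl
  total : IPF2total (suc (suc m)) ≡ eulerSum (suc (suc m))
  total =
    begin
      IPF2total (suc (suc m))
    ≡⟨ IPF2total≡lastAscentSum m ⟩
      ∑ (lastAscentWeight pow2) (perms (suc (suc m)))
    ≡⟨ lastAscentSum m pow2 ⟩
      ∑ (λ ℓ → suc (des ℓ) * 2 ^ ascL ℓ) (perms (suc m))
    ≡⟨ sym (eulerSum≡∑perms m) ⟩
      eulerSum (suc (suc m))
    ∎
    where open ≡-Reasoning
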